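{- Let $r\geq 2$ and let $\mathcal{H}$ be an $r$-tree with tree-defining ordering $E_1,\dots,E_m$. For each vertex $x$ let $\mathcal{H}_x$ denote the subgraph consisting of the edges containing $x$. Suppose $S$ is a cross-cut of $\mathcal{H}$ with $|S|\geq 2$. Then there exists $w\in S$ such that $\mathcal{H}'=\mathcal{H}\setminus\mathcal{H}_w$ is an $r$-tree. Furthermore, there exist $E\in\mathcal{H}_w$ and $F\in\mathcal{H}'$ such that $E$ is a starting edge of $\mathcal{H}_w$ and $V(\mathcal{H}_w)\cap V(\mathcal{H}')=E\cap F$.
   Context: An $r$-tree is an $r$-uniform hypergraph whose edges can be ordered $E_1,\dots,E_m$ (tree-defining ordering) so that for each $i>1$ there is $\alpha(i)<i$ with $E_i\cap\bigcup_{j<i}E_j\subseteq E_{\alpha(i)}$; a starting edge is the first edge of some tree-defining ordering. A cross-cut is a vertex set containing exactly one vertex of each edge. $\mathcal{H}\setminus\mathcal{H}_w$ denotes $\mathcal{H}$ with the edges of $\mathcal{H}_w$ removed. -}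

module Defs where

open import Data.Nat using (ℕ)
open import Data.Fin using (Fin)
open import Data.Fin.Subset using (Subset; _∩_; _∪_; _⊆_; ⋃; ∣_∣)
open import Data.Fin.Subset.Properties using (_∈?_)
open import Data.List using (List; []; _∷_; _++_; [_]; filter)
open import Data.List.Relation.Unary.All using (All)
open import Data.List.Relation.Unary.Any using (Any)
open import Data.List.Relation.Unary.Unique.Propositional using (Unique)
open import Data.List.Relation.Binary.Permutation.Propositional using (_↭_)
open import Data.Product using (Σ; _×_)
open import Data.Unit using (⊤)
open import Relation.Binary.PropositionalEquality using (_≡_)
open import Relation.Nullary.Decidable using (¬?)

Hypergraph : ℕ → Set
Hypergraph n = List (Subset n)

-- r-uniform hypergraph (as a set of edges: no repeated edges).
Uniform : ∀ {n} → ℕ → Hypergraph n → Set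
Uniform r H = All (λ E → ∣ E ∣ ≡ r) H × Unique H

TreeCondFrom : ∀ {n} → List (Subset n) → List (Subset n) → Set
TreeCondFrom prev [] = ⊤
TreeCondFrom prev (F ∷ fs) =
  Any (λ A → (F ∩ ⋃ prev) ⊆ A) prev × TreeCondFrom (prev ++ [ F ]) fs

TreeOrdering : ∀ {n} → List (Subset n) → Set
TreeOrdering [] = ⊤
TreeOrdering (E ∷ rest) = TreeCondFrom [ E ] rest

IsRTree : ∀ {n} → ℕ → Hypergraph n → Set
IsRTree r H = Uniform r H × Σ (List _) (λ L → (L ↭ H) × TreeOrdering L)

StartingEdge : ∀ {n} → Subset n → Hypergraph n → Set
StartingEdge E H = Σ (List _) (λ rest → ((E ∷ rest) ↭ H) × TreeOrdering (E ∷ rest))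

V : ∀ {n} → Hypergraph n → Subset n
V H = ⋃ H

Star : ∀ {n} → Fin n → Hypergraph n → Hypergraph n
Star x H = filter (λ E → x ∈? E) H

RemoveStar : ∀ {n} → Fin n → Hypergraph n → Hypergraph n
RemoveStar x H = filter (λ E → ¬? (x ∈? E)) H

CrossCut : ∀ {n} → Subset n → Hypergraph n → Set
CrossCut S H = (S ⊆ V H) × All (λ E → ∣ S ∩ E ∣ ≡ 1) H

module Submission where

-- Lemma 5.13.  Let E₁,…,Eₘ be a tree-defining ordering of H and S a cross-cut
-- with |S| ≥ 2.  Call an edge covered if its cut vertex already lies in an
-- earlier edge.  If every edge after E₁ were covered, S would lie inside E₁ and
-- |S| ≤ 1; so there is a last uncovered edge E.  Write H = A, E, B and let w be
-- the cut vertex of E; then w ∉ V(A).  Every edge F of B is covered, and this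
-- puts F on the same side of w as its tree parent X: if w ∈ F then w ∈ X since
-- w ∈ F ∩ ⋃(earlier) ⊆ X; if w ∈ X, then w is the only cut vertex of X, while
-- the cut vertex of F lies in F ∩ ⋃(earlier) ⊆ X, so it is w and w ∈ F.
-- Two general facts about orderings whose parents lie on the same side then
-- finish the proof: filtering such an ordering keeps it tree-defining (giving
-- the orderings A,(B ∖ H_w) of H ∖ H_w and E,(B ∩ H_w) of H_w), and a vertex
-- shared by the two sides already lies in E ∩ F₀, where F₀ is E's parent in A.

open import Defs
open import Data.Nat using (ℕ; suc; _≤_)
open import Data.Nat.Properties using (≤⇒≯; m≤n⇒m≤1+n; suc-injective)
open import Data.Fin using (Fin; zero; suc)
open import Data.Fin.Subset using (Subset; _∩_; ∣_∣; ⋃; inside; outside; _⊆_) renaming (_∈_ to _∈ₛ_; _∉_ to _∉ₛ_)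
open import Data.Fin.Subset.Properties using (_∈?_; ∉⊥; ∣⊥∣≡0; x∈p∪q⁻; x∈p∪q⁺; x∈p∩q⁺; x∈p∩q⁻; ⊆-antisym; p⊆q⇒∣p∣≤∣q∣)
open import Data.Vec using ([]; _∷_; _[_]=_)
open _[_]=_
open import Data.List using (List; []; _∷_; _++_; [_]; filter)
open import Data.List.Properties using (++-assoc; ++-identityʳ; filter-++; filter-accept; filter-reject; filter-none; filter-all)
open import Data.List.Membership.Propositional using (_∈_; find; lose)
open import Data.List.Membership.Propositional.Properties using (∈-filter⁺; ∈-filter⁻)
open import Data.List.Relation.Unary.Any as Any using (Any; here; there)
import Data.List.Relation.Unary.Any.Properties as AnyP
open import Data.List.Relation.Unary.All as All using (All; []; _∷_)
import Data.List.Relation.Unary.All.Properties as AllP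
import Data.List.Relation.Unary.Unique.Propositional.Properties as UniqueP
open import Data.List.Relation.Binary.Permutation.Propositional using (↭-reflexive)
open import Data.Product using (Σ; _×_; _,_; ∃; proj₁; proj₂)
open import Data.Sum using (_⊎_; inj₁; inj₂) renaming ([_,_] to either)
open import Data.Unit using (⊤; tt)
open import Function using (id)
open import Relation.Nullary using (¬_; yes; no; contradiction; contraposition)
open import Relation.Nullary.Decidable using (¬?)
open import Relation.Unary using (Decidable)
open import Relation.Binary.PropositionalEquality using (_≡_; refl; sym; trans; cong; cong₂; subst)

private
  variable
    n : ℕ

size-zero-empty : ∀ (p : Subset n) {x} → ∣ p ∣ ≡ 0 → x ∉ₛ p
size-zero-empty (outside ∷ p) eq (there x∈p) = size-zero-empty p eq x∈p

size-one-element : ∀ (p : Subset n) → ∣ p ∣ ≡ 1 → ∃ λ x → x ∈ₛ p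
size-one-element (inside ∷ p) eq = zero , here
size-one-element (outside ∷ p) eq with size-one-element p eq
... | x , x∈p = suc x , there x∈p

size-one-unique : ∀ (p : Subset n) {x y} → ∣ p ∣ ≡ 1 → x ∈ₛ p → y ∈ₛ p → x ≡ y
size-one-unique (inside ∷ p) eq here here = refl
size-one-unique (inside ∷ p) eq here (there y∈p) = contradiction y∈p (size-zero-empty p (suc-injective eq))
size-one-unique (inside ∷ p) eq (there x∈p) _ = contradiction x∈p (size-zero-empty p (suc-injective eq))
size-one-unique (outside ∷ p) eq (there x∈p) (there y∈p) = cong suc (size-one-unique p eq x∈p y∈p)

⊆-or-witness : ∀ (p q : Subset n) → p ⊆ q ⊎ ∃ λ x → x ∈ₛ p × x ∉ₛ q
⊆-or-witness [] [] = inj₁ id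
⊆-or-witness (s ∷ p) (t ∷ q) with ⊆-or-witness p q
... | inj₂ (x , x∈p , x∉q) = inj₂ (suc x , there x∈p , λ { (there x∈q) → x∉q x∈q })
... | inj₁ p⊆q with s | t
...   | outside | _       = inj₁ λ { (there x∈p) → there (p⊆q x∈p) }
...   | inside  | inside  = inj₁ λ { here → here ; (there x∈p) → there (p⊆q x∈p) }
...   | inside  | outside = inj₂ (zero , here , λ ())

∈⋃⁺ : ∀ {L : List (Subset n)} {x} → Any (x ∈ₛ_) L → x ∈ₛ ⋃ L
∈⋃⁺ (here x∈X) = x∈p∪q⁺ (inj₁ x∈X)
∈⋃⁺ (there x∈L) = x∈p∪q⁺ (inj₂ (∈⋃⁺ x∈L))

∈⋃⁻ : ∀ (L : List (Subset n)) {x} → x ∈ₛ ⋃ L → Any (x ∈ₛ_) L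
∈⋃⁻ [] x∈⊥ = contradiction x∈⊥ ∉⊥
∈⋃⁻ (X ∷ L) x∈⋃ = either here (λ x∈⋃L → there (∈⋃⁻ L x∈⋃L)) (x∈p∪q⁻ X (⋃ L) x∈⋃)

∈⋃-++⁺ˡ : ∀ (xs : List (Subset n)) {ys x} → x ∈ₛ ⋃ xs → x ∈ₛ ⋃ (xs ++ ys)
∈⋃-++⁺ˡ xs x∈⋃ = ∈⋃⁺ (AnyP.++⁺ˡ (∈⋃⁻ xs x∈⋃))

∈⋃-snoc⁻ : ∀ (xs : List (Subset n)) {F x} → x ∈ₛ ⋃ (xs ++ [ F ]) → x ∈ₛ ⋃ xs ⊎ x ∈ₛ F
∈⋃-snoc⁻ xs x∈⋃ with AnyP.++⁻ xs (∈⋃⁻ (xs ++ _) x∈⋃)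
... | inj₁ x∈xs = inj₁ (∈⋃⁺ x∈xs)
... | inj₂ (here x∈F) = inj₂ x∈F

∈⋃-filter⁻ : ∀ {Q : Subset n → Set} (Q? : Decidable Q) (L : List (Subset n)) {x} →
  x ∈ₛ ⋃ (filter Q? L) → Any (λ X → Q X × x ∈ₛ X) L
∈⋃-filter⁻ Q? L x∈⋃ with find (∈⋃⁻ (filter Q? L) x∈⋃)
... | X , X∈filter , x∈X with ∈-filter⁻ Q? {xs = L} X∈filter
...   | X∈L , qX = lose X∈L (qX , x∈X)

filter-snoc-accept : ∀ {Q : Subset n → Set} (Q? : Decidable Q) xs {F} → Q F →
  filter Q? (xs ++ [ F ]) ≡ filter Q? xs ++ [ F ]
filter-snoc-accept Q? xs qF = trans (filter-++ Q? xs _) (cong (filter Q? xs ++_) (filter-accept Q? qF))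

filter-snoc-reject : ∀ {Q : Subset n → Set} (Q? : Decidable Q) xs {F} → ¬ Q F →
  filter Q? (xs ++ [ F ]) ≡ filter Q? xs
filter-snoc-reject Q? xs ¬qF =
  trans (filter-++ Q? xs _) (trans (cong (filter Q? xs ++_) (filter-reject Q? ¬qF)) (++-identityʳ _))

tree-split : ∀ (prev xs ys : List (Subset n)) → TreeCondFrom prev (xs ++ ys) →
  TreeCondFrom prev xs × TreeCondFrom (prev ++ xs) ys
tree-split prev [] ys t = tt , subst (λ Z → TreeCondFrom Z ys) (sym (++-identityʳ prev)) t
tree-split prev (x ∷ xs) ys (parent , t) with tree-split (prev ++ [ x ]) xs ys t
... | t₁ , t₂ = (parent , t₁) , subst (λ Z → TreeCondFrom Z ys) (++-assoc prev [ x ] xs) t₂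

tree-join : ∀ (prev xs ys : List (Subset n)) → TreeCondFrom prev xs →
  TreeCondFrom (prev ++ xs) ys → TreeCondFrom prev (xs ++ ys)
tree-join prev [] ys _ t = subst (λ Z → TreeCondFrom Z ys) (++-identityʳ prev) t
tree-join prev (x ∷ xs) ys (parent , t₁) t₂ =
  parent , tree-join (prev ++ [ x ]) xs ys t₁ (subst (λ Z → TreeCondFrom Z ys) (sym (++-assoc prev [ x ] xs)) t₂)

ordering-extend : ∀ (xs ys : List (Subset n)) → TreeOrdering xs → TreeCondFrom xs ys → TreeOrdering (xs ++ ys)
ordering-extend [] [] _ _ = tt
ordering-extend [] (y ∷ ys) _ (() , _)
ordering-extend (x ∷ xs) ys t₁ t₂ = tree-join [ x ] xs ys t₁ t₂

Stepwise : (List (Subset n) → Subset n → Set) → List (Subset n) → List (Subset n) → Set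
Stepwise P prev [] = ⊤
Stepwise P prev (F ∷ fs) = P prev F × Stepwise P (prev ++ [ F ]) fs

Parented : (Subset n → Subset n → Set) → List (Subset n) → List (Subset n) → Set
Parented R = Stepwise (λ prev F → Any (λ X → F ∩ ⋃ prev ⊆ X × R F X) prev)

SameSide : (Subset n → Set) → Subset n → Subset n → Set
SameSide Q F X = (Q F → Q X) × (Q X → Q F)

-- Filtering by a property that passes from a child to its chosen parent keeps the
-- tree condition: the parent of a surviving edge survives too.
filter-tree : ∀ {Q : Subset n → Set} {R} (Q? : Decidable Q) → (∀ {F X} → R F X → Q F → Q X) →
  ∀ prev fs → Parented R prev fs → TreeCondFrom (filter Q? prev) (filter Q? fs)
filter-tree Q? inherit prev [] _ = tt
filter-tree Q? inherit prev (F ∷ fs) (parent , rest) with Q? F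
... | yes qF = surviving-parent ,
  subst (λ Z → TreeCondFrom Z (filter Q? fs)) (filter-snoc-accept Q? prev qF) (filter-tree Q? inherit _ fs rest)
  where
  surviving-parent : Any (λ X → F ∩ ⋃ (filter Q? prev) ⊆ X) (filter Q? prev)
  surviving-parent with find parent
  ... | X , X∈prev , F∩prev⊆X , rFX = lose (∈-filter⁺ Q? X∈prev (inherit rFX qF)) λ x∈F∩ →
    let x∈F , x∈⋃ = x∈p∩q⁻ F _ x∈F∩
    in F∩prev⊆X (x∈p∩q⁺ (x∈F , ∈⋃⁺ (Any.map proj₂ (∈⋃-filter⁻ Q? prev x∈⋃))))
... | no ¬qF =
  subst (λ Z → TreeCondFrom Z (filter Q? fs)) (filter-snoc-reject Q? prev ¬qF) (filter-tree Q? inherit _ fs rest)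

Separates : (Subset n → Set) → List (Subset n) → Subset n → Set
Separates Q P D = ∀ {x} → Any (λ X → Q X × x ∈ₛ X) P → Any (λ X → ¬ Q X × x ∈ₛ X) P → x ∈ₛ D

-- A new edge with a same-side parent creates no new shared vertices: a vertex of
-- F seen earlier lies in F's parent, which is on F's side.
separates-snoc : ∀ {Q : Subset n → Set} {P F D} →
  Any (λ X → F ∩ ⋃ P ⊆ X × SameSide Q F X) P → Separates Q P D → Separates Q (P ++ [ F ]) D
separates-snoc {P = P} parent sep inQ notQ with AnyP.++⁻ P inQ | AnyP.++⁻ P notQ
... | inj₁ inQ′ | inj₁ notQ′ = sep inQ′ notQ′
... | inj₂ (here (qF , _)) | inj₂ (here (¬qF , _)) = contradiction qF ¬qF
... | inj₂ (here (qF , x∈F)) | inj₁ notQ′ =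
  sep (Any.map (λ (F∩P⊆X , same) → proj₁ same qF ,
                                    F∩P⊆X (x∈p∩q⁺ (x∈F , ∈⋃⁺ (Any.map proj₂ notQ′)))) parent)
      notQ′
... | inj₁ inQ′ | inj₂ (here (¬qF , x∈F)) =
  sep inQ′
      (Any.map (λ (F∩P⊆X , same) → contraposition (proj₂ same) ¬qF ,
                                    F∩P⊆X (x∈p∩q⁺ (x∈F , ∈⋃⁺ (Any.map proj₂ inQ′)))) parent)

separates-extend : ∀ {Q : Subset n → Set} P fs {D} →
  Parented (SameSide Q) P fs → Separates Q P D → Separates Q (P ++ fs) D
separates-extend {Q = Q} P [] {D} _ sep = subst (λ Z → Separates Q Z D) (sym (++-identityʳ P)) sep
separates-extend {Q = Q} P (F ∷ fs) {D} (parent , rest) sep =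
  subst (λ Z → Separates Q Z D) (++-assoc P [ F ] fs) (separates-extend (P ++ [ F ]) fs rest (separates-snoc parent sep))

StarRemoval : ℕ → Fin n → Hypergraph n → Set
StarRemoval {n} r w H = IsRTree r (RemoveStar w H) ×
  Σ (Subset n) (λ E → Σ (Subset n) (λ F →
    (E ∈ Star w H) × (F ∈ RemoveStar w H) × StartingEdge E (Star w H) ×
    (V (Star w H) ∩ V (RemoveStar w H) ≡ E ∩ F)))

star-removal : ∀ {r} (A : List (Subset n)) (E : Subset n) (B : List (Subset n)) {w} →
  w ∉ₛ ⋃ A → w ∈ₛ E → Uniform r (A ++ E ∷ B) → TreeOrdering A →
  Any (λ X → E ∩ ⋃ A ⊆ X) A → Parented (SameSide (w ∈ₛ_)) (A ++ [ E ]) B →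
  StarRemoval r w (A ++ E ∷ B)
star-removal {n} A E B {w} w∉A w∈E (sizes , unique) treeA parentE sameSide with find parentE
... | F₀ , F₀∈A , E∩A⊆F₀ =
  ((AllP.filter⁺ out? sizes , UniqueP.filter⁺ out? unique) , _ , ↭-reflexive (sym remove-split) , tree) ,
  E , F₀ , E∈star , F₀∈remove , starting , ⊆-antisym shared⊆E∩F₀ E∩F₀⊆shared
  where
  H : Hypergraph n
  H = A ++ E ∷ B

  in? : Decidable (w ∈ₛ_)
  in? X = w ∈? X

  out? : Decidable (λ X → w ∉ₛ X)
  out? X = ¬? (w ∈? X)

  A-outside : All (λ X → w ∉ₛ X) A
  A-outside = All.tabulate λ X∈A w∈X → w∉A (∈⋃⁺ (lose X∈A w∈X))

  star-split : Star w H ≡ E ∷ filter in? B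
  star-split = trans (filter-++ in? A (E ∷ B)) (cong₂ _++_ (filter-none in? A-outside) (filter-accept in? w∈E))

  remove-split : RemoveStar w H ≡ A ++ filter out? B
  remove-split = trans (filter-++ out? A (E ∷ B)) (cong₂ _++_ (filter-all out? A-outside) (filter-reject out? (λ w∉E → w∉E w∈E)))

  tree : TreeOrdering (A ++ filter out? B)
  tree = ordering-extend A _ treeA
    (subst (λ Z → TreeCondFrom Z (filter out? B))
      (trans (filter-snoc-reject out? A (λ w∉E → w∉E w∈E)) (filter-all out? A-outside))
      (filter-tree out? (λ same → contraposition (proj₂ same)) (A ++ [ E ]) B sameSide))

  starting : StartingEdge E (Star w H)
  starting = _ , ↭-reflexive (sym star-split) ,
    subst (λ Z → TreeCondFrom Z (filter in? B))
      (trans (filter-snoc-accept in? A w∈E) (cong (_++ [ E ]) (filter-none in? A-outside)))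
      (filter-tree in? proj₁ (A ++ [ E ]) B sameSide)

  E∈star : E ∈ Star w H
  E∈star = ∈-filter⁺ in? (AnyP.++⁺ʳ A (here refl)) w∈E

  F₀∈remove : F₀ ∈ RemoveStar w H
  F₀∈remove = ∈-filter⁺ out? (AnyP.++⁺ˡ F₀∈A) (All.lookup A-outside F₀∈A)

  -- Among A, E only E contains w, and E meets A inside its parent F₀.
  separates-initial : Separates (w ∈ₛ_) (A ++ [ E ]) (E ∩ F₀)
  separates-initial inQ notQ with AnyP.++⁻ A inQ | AnyP.++⁻ A notQ
  ... | inj₁ inA | _ with find inA
  ...   | X , X∈A , w∈X , _ = contradiction w∈X (All.lookup A-outside X∈A)
  separates-initial inQ notQ | inj₂ (here (_ , x∈E)) | inj₂ (here (w∉E , _)) = contradiction w∈E w∉E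
  separates-initial inQ notQ | inj₂ (here (_ , x∈E)) | inj₁ notA =
    x∈p∩q⁺ (x∈E , E∩A⊆F₀ (x∈p∩q⁺ (x∈E , ∈⋃⁺ (Any.map proj₂ notA))))

  separates-all : Separates (w ∈ₛ_) H (E ∩ F₀)
  separates-all = subst (λ Z → Separates (w ∈ₛ_) Z (E ∩ F₀)) (++-assoc A [ E ] B)
    (separates-extend (A ++ [ E ]) B sameSide separates-initial)

  shared⊆E∩F₀ : V (Star w H) ∩ V (RemoveStar w H) ⊆ E ∩ F₀
  shared⊆E∩F₀ x∈shared =
    let x∈star , x∈remove = x∈p∩q⁻ (V (Star w H)) _ x∈shared
    in separates-all (∈⋃-filter⁻ in? H x∈star) (∈⋃-filter⁻ out? H x∈remove)

  E∩F₀⊆shared : E ∩ F₀ ⊆ V (Star w H) ∩ V (RemoveStar w H)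
  E∩F₀⊆shared x∈E∩F₀ =
    let x∈E , x∈F₀ = x∈p∩q⁻ E F₀ x∈E∩F₀
    in x∈p∩q⁺ (∈⋃⁺ (lose E∈star x∈E) , ∈⋃⁺ (lose F₀∈remove x∈F₀))

module CrossCutArgument (S : Subset n) where

  MeetsOnce : Subset n → Set
  MeetsOnce E = ∣ S ∩ E ∣ ≡ 1

  Covered : List (Subset n) → List (Subset n) → Set
  Covered = Stepwise (λ prev F → S ∩ F ⊆ ⋃ prev)

  covered-⊆ : ∀ prev fs → Covered prev fs → ∀ {x} → x ∈ₛ S → x ∈ₛ ⋃ fs → x ∈ₛ ⋃ prev
  covered-⊆ prev [] _ _ x∈⊥ = contradiction x∈⊥ ∉⊥
  covered-⊆ prev (F ∷ fs) (S∩F⊆prev , cov) {x} x∈S x∈⋃ = either from-F from-rest (x∈p∪q⁻ F (⋃ fs) x∈⋃)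
    where
    from-F : x ∈ₛ F → x ∈ₛ ⋃ prev
    from-F x∈F = S∩F⊆prev (x∈p∩q⁺ (x∈S , x∈F))
    from-rest : x ∈ₛ ⋃ fs → x ∈ₛ ⋃ prev
    from-rest x∈fs = either id from-F (∈⋃-snoc⁻ prev (covered-⊆ (prev ++ [ F ]) fs cov x∈S x∈fs))

  record LastUncovered (prev fs : List (Subset n)) : Set where
    constructor last-uncovered-at
    field
      before : List (Subset n)
      edge : Subset n
      after : List (Subset n)
      split : fs ≡ before ++ edge ∷ after
      fresh : ∃ λ w → w ∈ₛ S ∩ edge × w ∉ₛ ⋃ (prev ++ before)
      covered : Covered ((prev ++ before) ++ [ edge ]) after

  find-last-uncovered : ∀ prev fs → Covered prev fs ⊎ LastUncovered prev fs
  find-last-uncovered prev [] = inj₁ tt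
  find-last-uncovered prev (F ∷ fs) with find-last-uncovered (prev ++ [ F ]) fs
  ... | inj₂ later = inj₂ (shift later)
    where
    shift : LastUncovered (prev ++ [ F ]) fs → LastUncovered prev (F ∷ fs)
    shift (last-uncovered-at B₁ E B₂ refl fresh cov) =
      last-uncovered-at (F ∷ B₁) E B₂ refl
        (subst (λ Z → ∃ λ w → w ∈ₛ S ∩ E × w ∉ₛ ⋃ Z) (++-assoc prev [ F ] B₁) fresh)
        (subst (λ Z → Covered (Z ++ [ E ]) B₂) (++-assoc prev [ F ] B₁) cov)
  ... | inj₁ cov with ⊆-or-witness (S ∩ F) (⋃ prev)
  ...   | inj₁ S∩F⊆prev = inj₁ (S∩F⊆prev , cov)
  ...   | inj₂ (w , w∈S∩F , w∉prev) = inj₂ (last-uncovered-at [] F fs refl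
          (w , w∈S∩F , subst (λ Z → w ∉ₛ ⋃ Z) (sym (++-identityʳ prev)) w∉prev)
          (subst (λ Z → Covered (Z ++ [ F ]) fs) (sym (++-identityʳ prev)) cov))

  all-covered⇒small : ∀ E₁ R → S ⊆ V (E₁ ∷ R) → MeetsOnce E₁ → Covered [ E₁ ] R → ∣ S ∣ ≤ 1
  all-covered⇒small E₁ R S⊆V onceE₁ cov =
    subst (∣ S ∣ ≤_) onceE₁ (p⊆q⇒∣p∣≤∣q∣ λ x∈S → x∈p∩q⁺ (x∈S , in-E₁ x∈S (x∈p∪q⁻ E₁ (⋃ R) (S⊆V x∈S))))
    where
    in-E₁ : ∀ {x} → x ∈ₛ S → x ∈ₛ E₁ ⊎ x ∈ₛ ⋃ R → x ∈ₛ E₁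
    in-E₁ x∈S (inj₁ x∈E₁) = x∈E₁
    in-E₁ x∈S (inj₂ x∈R) with x∈p∪q⁻ E₁ _ (covered-⊆ [ E₁ ] R cov x∈S x∈R)
    ... | inj₁ x∈E₁ = x∈E₁
    ... | inj₂ x∈⊥ = contradiction x∈⊥ ∉⊥

  same-side-parent : ∀ {w F X P} → w ∈ₛ S → w ∈ₛ ⋃ P → MeetsOnce F → MeetsOnce X →
    S ∩ F ⊆ ⋃ P → F ∩ ⋃ P ⊆ X → SameSide (w ∈ₛ_) F X
  same-side-parent {w} {F} {X} w∈S w∈P onceF onceX S∩F⊆P F∩P⊆X = inherit , return
    where
    inherit : w ∈ₛ F → w ∈ₛ X
    inherit w∈F = F∩P⊆X (x∈p∩q⁺ (w∈F , w∈P))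
    return : w ∈ₛ X → w ∈ₛ F
    return w∈X with size-one-element (S ∩ F) onceF
    ... | u , u∈S∩F with x∈p∩q⁻ S F u∈S∩F
    ...   | u∈S , u∈F = subst (_∈ₛ F) u≡w u∈F
      where
      -- the cut vertex u of F was seen earlier, so it lies in F ∩ ⋃ P ⊆ X
      u∈X : u ∈ₛ X
      u∈X = F∩P⊆X (x∈p∩q⁺ (u∈F , S∩F⊆P u∈S∩F))
      -- and X has only one cut vertex, namely w
      u≡w : u ≡ w
      u≡w = size-one-unique (S ∩ X) onceX (x∈p∩q⁺ (u∈S , u∈X)) (x∈p∩q⁺ (w∈S , w∈X))

  same-side : ∀ {w} → w ∈ₛ S → ∀ P fs → All MeetsOnce P → w ∈ₛ ⋃ P → All MeetsOnce fs →
    TreeCondFrom P fs → Covered P fs → Parented (SameSide (w ∈ₛ_)) P fs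
  same-side w∈S P [] _ _ _ _ _ = tt
  same-side {w} w∈S P (F ∷ fs) onceP w∈P (onceF ∷ onceFs) (parent , tree) (S∩F⊆P , cov) =
    same-side-parent-of parent ,
    same-side w∈S (P ++ [ F ]) fs (AllP.++⁺ onceP (onceF ∷ [])) (∈⋃-++⁺ˡ P w∈P) onceFs tree cov
    where
    same-side-parent-of : Any (λ X → F ∩ ⋃ P ⊆ X) P → Any (λ X → F ∩ ⋃ P ⊆ X × SameSide (w ∈ₛ_) F X) P
    same-side-parent-of parent with find parent
    ... | X , X∈P , F∩P⊆X =
      lose X∈P (F∩P⊆X , same-side-parent {P = P} w∈S w∈P onceF (All.lookup onceP X∈P) S∩F⊆P F∩P⊆X)

  removal-at-last-uncovered : ∀ {r} E₁ R → Uniform r (E₁ ∷ R) → TreeOrdering (E₁ ∷ R) →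
    All MeetsOnce (E₁ ∷ R) → LastUncovered [ E₁ ] R → Σ (Fin n) (λ w → w ∈ₛ S × StarRemoval r w (E₁ ∷ R))
  removal-at-last-uncovered E₁ R uniform tree once (last-uncovered-at B₁ E B₂ refl (w , w∈S∩E , w∉A) cov)
    with tree-split [ E₁ ] B₁ (E ∷ B₂) tree | x∈p∩q⁻ S E w∈S∩E | AllP.++⁻ (E₁ ∷ B₁) once
  ... | treeA , parentE , treeB | w∈S , w∈E | onceA , onceE ∷ onceB =
    w , w∈S , star-removal (E₁ ∷ B₁) E B₂ w∉A w∈E uniform treeA parentE
      (same-side w∈S (E₁ ∷ B₁ ++ [ E ]) B₂ (AllP.++⁺ onceA (onceE ∷ []))
        (∈⋃⁺ (AnyP.++⁺ʳ (E₁ ∷ B₁) (here w∈E))) onceB treeB cov)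

open CrossCutArgument

lemma5p13 : (r n : ℕ) → 2 ≤ r → (H : List (Subset n)) →
    Uniform r H → TreeOrdering H →
    (S : Subset n) → CrossCut S H → 2 ≤ ∣ S ∣ →
    Σ (Fin n) (λ w → (w ∈ₛ S) × IsRTree r (RemoveStar w H) ×
      Σ (Subset n) (λ E → Σ (Subset n) (λ F →
        (E ∈ Star w H) × (F ∈ RemoveStar w H) × StartingEdge E (Star w H) ×
        (V (Star w H) ∩ V (RemoveStar w H) ≡ E ∩ F))))
lemma5p13 r n _ [] _ _ S (S⊆V , _) 2≤∣S∣ =
  contradiction 2≤∣S∣ (≤⇒≯ (m≤n⇒m≤1+n (subst (∣ S ∣ ≤_) (∣⊥∣≡0 n) (p⊆q⇒∣p∣≤∣q∣ S⊆V))))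
lemma5p13 r n _ (E₁ ∷ R) uniform tree S (S⊆V , once) 2≤∣S∣ with find-last-uncovered S [ E₁ ] R
... | inj₁ cov = contradiction 2≤∣S∣ (≤⇒≯ (all-covered⇒small S E₁ R S⊆V (All.head once) cov))
... | inj₂ last = removal-at-last-uncovered S E₁ R uniform tree once last
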